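{- Let $p \geq 2$ be a prime number and let $(s(n))_{n \geq 0}$ be a sequence of pairwise distinct integers satisfying the following two conditions: (1) for all integers $k \geq 0$ and every integer $m$ with $1 \leq m < p^{k+1}$, there exist integers $i, j$ with $0 \leq i < j \leq p^k$ and $m \mid s(j) - s(i)$; (2) for all integers $k \geq 0$ and all integers $i, j$ with $0 \leq i < j < p^{k+1}$, we have $p^{k+1} \nmid s(j) - s(i)$. Then $D_s(n) = p^{\lceil \log_p n \rceil}$ for every integer $n > 0$.
   Context: For a sequence $s = (s(i))_{i \geq 0}$ of pairwise distinct integers and an integer $n \geq 1$, the discriminator $D_s(n)$ is the least positive integer $m$ such that $s(0), s(1), \ldots, s(n-1)$ are pairwise incongruent modulo $m$. Note $p^{\lceil \log_p n \rceil}$ is the smallest power of $p$ that is $\geq n$. -}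

module Defs where

open import Data.Nat using (ℕ; _≤_; _<_; _^_)
open import Data.Integer using (ℤ; +_; _-_)
open import Data.Integer.Divisibility using (_∣_)
open import Relation.Nullary using (¬_)

PairwiseIncongruent : (ℕ → ℤ) → ℕ → ℕ → Set
PairwiseIncongruent s n m =
  ∀ i j → i < j → j < n → ¬ ((+ m) ∣ (s j - s i))

IsDiscriminator : (ℕ → ℤ) → ℕ → ℕ → Set
IsDiscriminator s n m =
  (1 ≤ m) × PairwiseIncongruent s n m ×
  (∀ m′ → 1 ≤ m′ → m′ < m → ¬ PairwiseIncongruent s n m′)
  where open import Data.Product using (_×_)

IsCeilLog : ℕ → ℕ → ℕ → Set
IsCeilLog p n e = (n ≤ p ^ e) × (∀ e′ → n ≤ p ^ e′ → e ≤ e′)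
  where open import Data.Product using (_×_)

{-# OPTIONS --safe #-}
-- With e = ⌈log_p n⌉ we have p^(e-1) < n ≤ p^e. Condition (2) separates the
-- first p^e terms, hence the first n, modulo p^e; for every smaller modulus m,
-- condition (1) with k = e-1 yields a collision among the first p^(e-1)+1 ≤ n
-- terms.
module Submission where

open import Defs
open import Data.Nat using (ℕ; zero; suc; _≤_; _<_; _^_; s≤s; z≤n; _<?_)
open import Data.Nat.Primality using (Prime)
open import Data.Nat.Properties using (≤-trans; ≤-<-trans; <-≤-trans; <⇒≱; n<1+n; ≮⇒≥)
open import Data.Integer using (ℤ; +_; _-_)
open import Data.Integer.Divisibility using (_∣_)
open import Data.Product using (Σ; _×_; _,_)
open import Data.Empty using (⊥-elim)
open import Function.Definitions using (Injective)
open import Relation.Binary.PropositionalEquality using (_≡_)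
open import Relation.Nullary using (¬_; yes; no)

pairwiseIncongruent-≤1 : ∀ s {n} m → n ≤ 1 → PairwiseIncongruent s n m
pairwiseIncongruent-≤1 s m n≤1 i j i<j j<n =
  ⊥-elim (<⇒≱ (<-≤-trans j<n n≤1) (≤-trans (s≤s z≤n) i<j))

pairwiseIncongruent-≤ : ∀ s {n} m {n′} → n ≤ n′ →
  PairwiseIncongruent s n′ m → PairwiseIncongruent s n m
pairwiseIncongruent-≤ s m n≤n′ incong i j i<j j<n = incong i j i<j (<-≤-trans j<n n≤n′)

ceilLog-pred< : ∀ {p n k} → IsCeilLog p n (suc k) → p ^ k < n
ceilLog-pred< {p} {n} {k} (_ , least) with p ^ k <? n
... | yes pᵏ<n = pᵏ<n
... | no pᵏ≮n = ⊥-elim (<⇒≱ (n<1+n k) (least k (≮⇒≥ pᵏ≮n)))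

lemma1 : (p : ℕ) → Prime p → (s : ℕ → ℤ) → Injective _≡_ _≡_ s →
    (∀ k m → 1 ≤ m → m < p ^ suc k →
    Σ ℕ (λ i → Σ ℕ (λ j → i < j × j ≤ p ^ k × (+ m) ∣ (s j - s i)))) →
    (∀ k i j → i < j → j < p ^ suc k → ¬ ((+ (p ^ suc k)) ∣ (s j - s i))) →
    ∀ n → 1 ≤ n → ∀ e → IsCeilLog p n e → IsDiscriminator s n (p ^ e)
lemma1 p _ s _ _ _ n 1≤n zero (n≤1 , _) =
  ≤-trans 1≤n n≤1 , pairwiseIncongruent-≤1 s 1 n≤1 ,
  λ m′ 1≤m′ m′<1 → ⊥-elim (<⇒≱ m′<1 1≤m′)
lemma1 p _ s _ collide separate n 1≤n (suc k) ceilLog@(n≤pᵉ , _) =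
  ≤-trans 1≤n n≤pᵉ ,
  pairwiseIncongruent-≤ s (p ^ suc k) n≤pᵉ (separate k) ,
  smaller-collide
  where
  smaller-collide : ∀ m′ → 1 ≤ m′ → m′ < p ^ suc k → ¬ PairwiseIncongruent s n m′
  smaller-collide m′ 1≤m′ m′<pᵉ incong with collide k m′ 1≤m′ m′<pᵉ
  ... | i , j , i<j , j≤pᵏ , m′∣ = incong i j i<j (≤-<-trans j≤pᵏ (ceilLog-pred< ceilLog)) m′∣
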